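{- For any integer $1\le i<n$ and any elements $x_i,\dots,x_{n-1},y\in R$, in $\mathsf{IdCox}_\beta(S_n)$, \[ \widetilde{A}^{(\beta)}_i(y)\, A^{(\beta)}_i(x_{i})A^{(\beta)}_{i+1}(x_{i+1})\cdots A^{(\beta)}_{n-1}(x_{n-1}) = \prod_{j=i+1}^{n-1} A^{(\beta)}_{j}(x_{j-1}) \cdot \prod_{j=i}^{n-1} h^{(\beta)}_j(x_j\oplus y). \]
   Context: Let $R$ be a commutative ring and $\beta\in R$; $x\oplus y=x+y+\beta xy$. Let $S_n=\langle s_1,\dots,s_{n-1}\rangle$ with $s_i=(i,i+1)$, with Coxeter length $\ell$. $\mathsf{IdCox}_\beta(S_n)$ is the free $R$-module with basis $\pi_w$ ($w\in S_n$) and multiplication $\pi_v\pi_w=\pi_{vw}$ if $\ell(vw)=\ell(v)+\ell(w)$, $\pi_{s_i}^2=\beta\pi_{s_i}$. Write $\pi_i=\pi_{s_i}$, $h^{(\beta)}_i(x)=1+x\pi_i$, $A^{(\beta)}_i(x)=h^{(\beta)}_{n-1}(x)h^{(\beta)}_{n-2}(x)\cdots h^{(\beta)}_i(x)$ and $\widetilde{A}^{(\beta)}_i(x)=h^{(\beta)}_i(x)h^{(\beta)}_{i+1}(x)\cdots h^{(\beta)}_{n-1}(x)$ for $1\le i<n$. Products $\prod_{j=a}^bF_j$ mean $F_aF_{a+1}\cdots F_b$ (empty product $=1$). -}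

module Defs where

open import Level using (Level; _⊔_) renaming (suc to lsuc)
open import Data.Nat using (ℕ; zero; suc; _∸_; _≤_; _<_)
open import Algebra.Bundles using (CommutativeRing; Ring)
open import Algebra.Morphism.Structures using (module RingMorphisms)

-- IdCox_β(S_n) itself (free R-module on π_w, w ∈ S_n) is such an algebra,
-- with π i = π_{s_i}; it is the universal one.
record IdCoxAlgebra {c ℓ : Level} (R : CommutativeRing c ℓ)
         (β : CommutativeRing.Carrier R) (n : ℕ) (a ℓa : Level)
         : Set (c ⊔ ℓ ⊔ lsuc (a ⊔ ℓa)) where
  module R = CommutativeRing R
  field
    A : Ring a ℓa
  open Ring A
  field
    ι : R.Carrier → Carrier
    ι-isRingHom : RingMorphisms.IsRingHomomorphism R.rawRing rawRing ι
    ι-central : ∀ r z → ι r * z ≈ z * ι r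
    π : ℕ → Carrier
    π-quad : ∀ i → 1 ≤ i → i < n → π i * π i ≈ ι β * π i
    π-comm : ∀ i j → 1 ≤ i → suc (suc i) ≤ j → j < n → π i * π j ≈ π j * π i
    π-braid : ∀ i → 1 ≤ i → suc i < n →
              π i * π (suc i) * π i ≈ π (suc i) * π i * π (suc i)

module IdCoxNotation {c ℓ a ℓa : Level} {R : CommutativeRing c ℓ}
         {β : CommutativeRing.Carrier R} {n : ℕ}
         (I : IdCoxAlgebra R β n a ℓa) where
  open IdCoxAlgebra I
  open Ring A

  _⊕_ : R.Carrier → R.Carrier → R.Carrier
  x ⊕ y = R._+_ (R._+_ x y) (R._*_ β (R._*_ x y))

  h : ℕ → R.Carrier → Carrier
  h i x = 1# + ι x * π i

  prodUp : ℕ → ℕ → (ℕ → Carrier) → Carrier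
  prodUp a zero    F = 1#
  prodUp a (suc k) F = F a * prodUp (suc a) k F

  prodDown : ℕ → ℕ → (ℕ → Carrier) → Carrier
  prodDown a zero    F = 1#
  prodDown a (suc k) F = prodDown (suc a) k F * F a

  -- ∏_{j=a}^{b} F j = F a F (a+1) ... F b  (empty product = 1 if b < a)
  prodRange : ℕ → ℕ → (ℕ → Carrier) → Carrier
  prodRange a b F = prodUp a (suc b ∸ a) F

  Aβ : ℕ → R.Carrier → Carrier
  Aβ i x = prodDown i (n ∸ i) (λ j → h j x)

  Ãβ : ℕ → R.Carrier → Carrier
  Ãβ i x = prodUp i (n ∸ i) (λ j → h j x)

-- Everything follows from three relations among the factors h_i(x) = 1 + x π_i:
-- h_i(x) h_i(y) = h_i(x ⊕ y) (from π_i² = β π_i), the Yang–Baxter relation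
-- h_i(y) h_{i+1}(x ⊕ y) h_i(x) = h_{i+1}(x) h_i(x ⊕ y) h_{i+1}(y) (from the braid
-- relation), and commutation of h_i and h_j for |i - j| ≥ 2.  Pushing h_i(y)
-- through A_i(x) with these gives Ã_i(y) A_i(x) = A_{i+1}(x) h_i(x ⊕ y) Ã_{i+1}(y);
-- the theorem follows by induction on n - i, since h_i(x_i ⊕ y) commutes with the
-- remaining factors A_j(x_{j-1}), j ≥ i + 2.
module Submission where

open import Defs
open import Level using (Level)
open import Data.Nat using (ℕ; _≤_; _<_; _∸_; pred; suc; zero; z≤n; s≤s)
  renaming (_+_ to _+ℕ_)
open import Data.Nat.Properties
  using (≤-refl; ≤-trans; ≤-reflexive; n≤1+n; <-≤-trans; ≤-<-trans; <⇒≤; m≤m+n;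
         +-suc; m+[n∸m]≡n; m≤n⇒m∸n≡0; +-∸-assoc)
  renaming (+-identityʳ to +ℕ-identityʳ)
open import Algebra.Bundles using (CommutativeRing; Ring)
open import Algebra.Morphism.Structures using (module RingMorphisms)
import Algebra.Properties.Semigroup as SemigroupProperties
import Algebra.Properties.CommutativeSemigroup as CommutativeSemigroupProperties
import Algebra.Solver.CommutativeMonoid as CommutativeMonoidSolver
import Relation.Binary.Reasoning.Setoid as SetoidReasoning
open import Relation.Binary.PropositionalEquality as ≡ using (_≡_)

module IdCoxProperties {c ℓ a ℓa : Level} {R : CommutativeRing c ℓ}
         {β : CommutativeRing.Carrier R} {n : ℕ} (I : IdCoxAlgebra R β n a ℓa) where
  open IdCoxAlgebra I
  open Ring A
  open IdCoxNotation I
  open RingMorphisms.IsRingHomomorphism ι-isRingHom using (⟦⟧-cong; +-homo; *-homo)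
  open SemigroupProperties *-semigroup
    using ([uv∙w]x≈u[v∙wx]; [u∙vw]x≈u[v∙wx]; uv∙wx≈u[vw∙x])
  open CommutativeSemigroupProperties R.*-commutativeSemigroup using (xy∙z≈zy∙x)
  open SetoidReasoning setoid

  infixr 8 _·_
  _·_ : R.Carrier → Carrier → Carrier
  r · u = ι r * u

  ·-cong : ∀ {r s} u → r R.≈ s → r · u ≈ s · u
  ·-cong u r≈s = *-congʳ (⟦⟧-cong r≈s)

  ·-assoc : ∀ r s u → r · s · u ≈ (r R.* s) · u
  ·-assoc r s u = trans (sym (*-assoc _ _ _)) (*-congʳ (sym (*-homo r s)))

  ·-distribʳ : ∀ r s u → r · u + s · u ≈ (r R.+ s) · u
  ·-distribʳ r s u = trans (sym (distribʳ u (ι r) (ι s))) (*-congʳ (sym (+-homo r s)))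

  ·-*-· : ∀ r s u v → (r · u) * (s · v) ≈ (r R.* s) · (u * v)
  ·-*-· r s u v = begin
    (ι r * u) * (ι s * v) ≈⟨ *-assoc _ _ _ ⟩
    ι r * (u * (ι s * v)) ≈⟨ *-congˡ (sym (*-assoc _ _ _)) ⟩
    ι r * ((u * ι s) * v) ≈⟨ *-congˡ (*-congʳ (sym (ι-central s u))) ⟩
    ι r * ((ι s * u) * v) ≈⟨ *-congˡ (*-assoc _ _ _) ⟩
    r · s · (u * v)       ≈⟨ ·-assoc r s _ ⟩
    (r R.* s) · (u * v)   ∎

  ⊕-comm : ∀ r s → r ⊕ s R.≈ s ⊕ r
  ⊕-comm r s = R.+-cong (R.+-comm r s) (R.*-congˡ (R.*-comm r s))

  h-cong : ∀ i {r s} → r R.≈ s → h i r ≈ h i s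
  h-cong i r≈s = +-congˡ (·-cong _ r≈s)

  Commute : Carrier → Carrier → Set ℓa
  Commute u v = u * v ≈ v * u

  commute-1# : ∀ u → Commute u 1#
  commute-1# u = trans (*-identityʳ u) (sym (*-identityˡ u))

  commute-* : ∀ {u v w} → Commute u v → Commute u w → Commute u (v * w)
  commute-* {u} {v} {w} uv uw = begin
    u * (v * w) ≈⟨ sym (*-assoc u v w) ⟩
    (u * v) * w ≈⟨ *-congʳ uv ⟩
    (v * u) * w ≈⟨ *-assoc v u w ⟩
    v * (u * w) ≈⟨ *-congˡ uw ⟩
    v * (w * u) ≈⟨ sym (*-assoc v w u) ⟩
    (v * w) * u ∎

  commute-+ : ∀ {u v w} → Commute u v → Commute u w → Commute u (v + w)
  commute-+ {u} {v} {w} uv uw = begin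
    u * (v + w)   ≈⟨ distribˡ u v w ⟩
    u * v + u * w ≈⟨ +-cong uv uw ⟩
    v * u + w * u ≈⟨ sym (distribʳ u v w) ⟩
    (v + w) * u   ∎

  commute-h : ∀ {u} j r → Commute u (π j) → Commute u (h j r)
  commute-h {u} j r uπ = commute-+ (commute-1# u) (commute-* (sym (ι-central r u)) uπ)

  h-commute : ∀ {i j} r s → 1 ≤ i → suc (suc i) ≤ j → j < n → Commute (h i r) (h j s)
  h-commute {i} {j} r s 1≤i i+2≤j j<n =
    sym (commute-h i r (sym (commute-h j s (π-comm i j 1≤i i+2≤j j<n))))

  prodUp-commute : ∀ {u} j k F → (∀ l → j ≤ l → l < j +ℕ k → Commute u (F l)) →
                   Commute u (prodUp j k F)
  prodUp-commute {u} j zero    F uF = commute-1# u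
  prodUp-commute     j (suc k) F uF =
    commute-* (uF j ≤-refl (≡.subst (j <_) (≡.sym (+-suc j k)) (s≤s (m≤m+n j k))))
              (prodUp-commute (suc j) k F λ l j<l l<j+k →
                 uF l (<⇒≤ j<l) (≡.subst (l <_) (≡.sym (+-suc j k)) l<j+k))

  prodDown-commute : ∀ {u} j k F → (∀ l → j ≤ l → l < j +ℕ k → Commute u (F l)) →
                     Commute u (prodDown j k F)
  prodDown-commute {u} j zero    F uF = commute-1# u
  prodDown-commute     j (suc k) F uF =
    commute-* (prodDown-commute (suc j) k F λ l j<l l<j+k →
                 uF l (<⇒≤ j<l) (≡.subst (l <_) (≡.sym (+-suc j k)) l<j+k))
              (uF j ≤-refl (≡.subst (j <_) (≡.sym (+-suc j k)) (s≤s (m≤m+n j k))))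

  commute-swapˡ : ∀ {u v} w → Commute u v → u * (v * w) ≈ v * (u * w)
  commute-swapˡ w uv =
    trans (sym (*-assoc _ _ w)) (trans (*-congʳ uv) (*-assoc _ _ w))

  module +-Solver = CommutativeMonoidSolver +-commutativeMonoid

  expand₂ : ∀ u v → (1# + u) * (1# + v) ≈ 1# + u + v + u * v
  expand₂ u v = begin
    (1# + u) * (1# + v)             ≈⟨ distribˡ (1# + u) 1# v ⟩
    (1# + u) * 1# + (1# + u) * v    ≈⟨ +-cong (*-identityʳ _) (distribʳ v 1# u) ⟩
    (1# + u) + (1# * v + u * v)     ≈⟨ +-congˡ (+-congʳ (*-identityˡ v)) ⟩
    (1# + u) + (v + u * v)          ≈⟨ sym (+-assoc _ _ _) ⟩
    1# + u + v + u * v              ∎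

  expand₃ : ∀ u v w → (1# + u) * (1# + v) * (1# + w)
                      ≈ 1# + (u + w + u * w) + v + (u * v + v * w + u * v * w)
  expand₃ u v w = begin
    (1# + u) * (1# + v) * (1# + w)
      ≈⟨ *-congʳ (expand₂ u v) ⟩
    X * (1# + w)
      ≈⟨ distribˡ X 1# w ⟩
    X * 1# + X * w
      ≈⟨ +-cong (*-identityʳ X) (trans (distribʳ w _ _) (+-congʳ
           (trans (distribʳ w _ _) (+-congʳ (trans (distribʳ w _ _) (+-congʳ (*-identityˡ w))))))) ⟩
    X + (w + u * w + v * w + u * v * w)
      ≈⟨ +-Solver.solve 8 (λ e u v uv w uw vw uvw →
           (((e ⊞ u) ⊞ v) ⊞ uv) ⊞ (((w ⊞ uw) ⊞ vw) ⊞ uvw)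
           ⊜ ((e ⊞ ((u ⊞ w) ⊞ uw)) ⊞ v) ⊞ ((uv ⊞ vw) ⊞ uvw)) refl
           1# u v (u * v) w (u * w) (v * w) (u * v * w) ⟩
    1# + (u + w + u * w) + v + (u * v + v * w + u * v * w) ∎
    where
    X = 1# + u + v + u * v
    open +-Solver using (_⊜_) renaming (_⊕_ to _⊞_)

  absorb : ∀ {p} r s → p * p ≈ β · p → r · p + s · p + (r · p) * (s · p) ≈ (r ⊕ s) · p
  absorb {p} r s pp≈βp = begin
    r · p + s · p + (r · p) * (s · p)    ≈⟨ +-cong (·-distribʳ r s p) (·-*-· r s p p) ⟩
    (r R.+ s) · p + (r R.* s) · (p * p)  ≈⟨ +-congˡ (*-congˡ pp≈βp) ⟩
    (r R.+ s) · p + (r R.* s) · β · p    ≈⟨ +-congˡ (trans (·-assoc _ β p) (·-cong p (R.*-comm _ β))) ⟩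
    (r R.+ s) · p + (β R.* (r R.* s)) · p ≈⟨ ·-distribʳ _ _ p ⟩
    (r ⊕ s) · p                          ∎

  h-mul : ∀ {i} r s → 1 ≤ i → i < n → h i r * h i s ≈ h i (r ⊕ s)
  h-mul {i} r s 1≤i i<n = begin
    h i r * h i s                                       ≈⟨ expand₂ _ _ ⟩
    1# + r · π i + s · π i + (r · π i) * (s · π i)      ≈⟨ trans (+-congʳ (+-assoc _ _ _)) (+-assoc _ _ _) ⟩
    1# + (r · π i + s · π i + (r · π i) * (s · π i))    ≈⟨ +-congˡ (absorb r s (π-quad i 1≤i i<n)) ⟩
    h i (r ⊕ s)                                         ∎

  expand-pqp : ∀ {p q} a b c → p * p ≈ β · p →
               (1# + a · p) * (1# + c · q) * (1# + b · p)
               ≈ 1# + (a ⊕ b) · p + c · q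
                 + ((a R.* c) · (p * q) + (c R.* b) · (q * p) + (a R.* c R.* b) · (p * q * p))
  expand-pqp {p} {q} a b c pp≈βp = trans (expand₃ _ _ _)
    (+-cong (+-congʳ (+-congˡ (absorb a b pp≈βp)))
            (+-cong (+-cong (·-*-· a c p q) (·-*-· c b q p))
                    (trans (*-congʳ (·-*-· a c p q)) (·-*-· _ b _ p))))

  h-braid : ∀ {i} r s → 1 ≤ i → suc i < n →
            h i s * h (suc i) (r ⊕ s) * h i r ≈ h (suc i) r * h i (r ⊕ s) * h (suc i) s
  h-braid {i} r s 1≤i i+1<n = begin
    h i s * h (suc i) t * h i r
      ≈⟨ expand-pqp s r t (π-quad i 1≤i i<n) ⟩
    1# + (s ⊕ r) · p + t · q + ((s R.* t) · (p * q) + (t R.* r) · (q * p) + (s R.* t R.* r) · (p * q * p))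
      ≈⟨ +-cong (+-congʳ (+-congˡ (·-cong p (⊕-comm s r))))
                (+-cong (+-cong (·-cong _ (R.*-comm s t)) (·-cong _ (R.*-comm t r)))
                        (*-cong (⟦⟧-cong (xy∙z≈zy∙x s t r)) (π-braid i 1≤i i+1<n))) ⟩
    1# + t · p + t · q + ((t R.* s) · (p * q) + (r R.* t) · (q * p) + (r R.* t R.* s) · (q * p * q))
      ≈⟨ +-Solver.solve 6 (λ e a b x y z →
           ((e ⊞ a) ⊞ b) ⊞ ((x ⊞ y) ⊞ z) ⊜ ((e ⊞ b) ⊞ a) ⊞ ((y ⊞ x) ⊞ z)) refl _ _ _ _ _ _ ⟩
    1# + t · q + t · p + ((r R.* t) · (q * p) + (t R.* s) · (p * q) + (r R.* t R.* s) · (q * p * q))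
      ≈⟨ sym (expand-pqp r s t (π-quad (suc i) (s≤s z≤n) i+1<n)) ⟩
    h (suc i) r * h i t * h (suc i) s ∎
    where
    t = r ⊕ s
    p = π i
    q = π (suc i)
    i<n : i < n
    i<n = ≤-trans (n≤1+n (suc i)) i+1<n
    open +-Solver using (_⊜_) renaming (_⊕_ to _⊞_)

  hUp : ℕ → ℕ → R.Carrier → Carrier
  hUp i k y = prodUp i k (λ j → h j y)

  hDown : ℕ → ℕ → R.Carrier → Carrier
  hDown i k x = prodDown i k (λ j → h j x)

  hUp-hDown : ∀ m i x y → 1 ≤ i → i +ℕ m < n →
              hUp i (suc m) y * hDown i (suc m) x
              ≈ hDown (suc i) m x * (h i (x ⊕ y) * hUp (suc i) m y)
  hUp-hDown zero i x y 1≤i i<n = begin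
    (h i y * 1#) * (1# * h i x) ≈⟨ *-cong (*-identityʳ _) (*-identityˡ _) ⟩
    h i y * h i x               ≈⟨ trans (h-mul y x 1≤i (≡.subst (_< n) (+ℕ-identityʳ i) i<n)) (h-cong i (⊕-comm y x)) ⟩
    h i (x ⊕ y)                 ≈⟨ sym (trans (*-identityˡ _) (*-identityʳ _)) ⟩
    1# * (h i (x ⊕ y) * 1#)     ∎
  hUp-hDown (suc m) i x y 1≤i i+m+1<n = begin
    (Hy * (H1y * U)) * ((D * H1x) * Hx) ≈⟨ uv∙wx≈u[vw∙x] _ _ _ _ ⟩
    Hy * (((H1y * U) * (D * H1x)) * Hx) ≈⟨ *-congˡ (*-congʳ (hUp-hDown m (suc i) x y (s≤s z≤n) i+m<n)) ⟩
    Hy * ((D * (H1c * U)) * Hx)         ≈⟨ *-congˡ ([u∙vw]x≈u[v∙wx] _ _ _ _) ⟩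
    Hy * (D * (H1c * (U * Hx)))         ≈⟨ commute-swapˡ _ Hy-D ⟩
    D * (Hy * (H1c * (U * Hx)))         ≈⟨ *-congˡ (*-congˡ (*-congˡ (sym Hx-U))) ⟩
    D * (Hy * (H1c * (Hx * U)))         ≈⟨ *-congˡ (sym ([uv∙w]x≈u[v∙wx] _ _ _ _)) ⟩
    D * ((Hy * H1c * Hx) * U)           ≈⟨ *-congˡ (*-congʳ (h-braid x y 1≤i i+1<n)) ⟩
    D * ((H1x * Hc * H1y) * U)          ≈⟨ *-congˡ ([uv∙w]x≈u[v∙wx] _ _ _ _) ⟩
    D * (H1x * (Hc * (H1y * U)))        ≈⟨ sym (*-assoc _ _ _) ⟩
    (D * H1x) * (Hc * (H1y * U))        ∎
    where
    Hy = h i y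
    Hx = h i x
    Hc = h i (x ⊕ y)
    H1y = h (suc i) y
    H1x = h (suc i) x
    H1c = h (suc i) (x ⊕ y)
    U = hUp (suc (suc i)) m y
    D = hDown (suc (suc i)) m x
    i+m<n : suc i +ℕ m < n
    i+m<n = ≡.subst (_< n) (+-suc i m) i+m+1<n
    i+1<n : suc i < n
    i+1<n = ≤-<-trans (m≤m+n (suc i) m) i+m<n
    Hy-D : Commute Hy D
    Hy-D = prodDown-commute (suc (suc i)) m _ λ l i+2≤l l<i+2+m →
             h-commute y x 1≤i i+2≤l (<-≤-trans l<i+2+m i+m<n)
    Hx-U : Commute Hx U
    Hx-U = prodUp-commute (suc (suc i)) m _ λ l i+2≤l l<i+2+m →
             h-commute x y 1≤i i+2≤l (<-≤-trans l<i+2+m i+m<n)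

  prodUp-length : ∀ j {k k′} F → k ≡ k′ → prodUp j k F ≈ prodUp j k′ F
  prodUp-length j F k≡k′ = reflexive (≡.cong (λ k → prodUp j k F) k≡k′)

  Aβ-empty : ∀ {j} x → n ≤ j → Aβ j x ≈ 1#
  Aβ-empty {j} x n≤j = reflexive (≡.cong (λ k → prodDown j k (λ l → h l x)) (m≤n⇒m∸n≡0 n≤j))

  Ãβ-empty : ∀ {j} y → n ≤ j → Ãβ j y ≈ 1#
  Ãβ-empty {j} y n≤j = prodUp-length j _ (m≤n⇒m∸n≡0 n≤j)

  n∸i≡1+[n∸1+i] : ∀ {i} → i < n → n ∸ i ≡ suc (n ∸ suc i)
  n∸i≡1+[n∸1+i] = +-∸-assoc 1

  Ãβ-Aβ : ∀ {i} x y → 1 ≤ i → i < n →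
          Ãβ i y * Aβ i x ≈ Aβ (suc i) x * (h i (x ⊕ y) * Ãβ (suc i) y)
  Ãβ-Aβ {i} x y 1≤i i<n = begin
    Ãβ i y * Aβ i x
      ≈⟨ *-cong (prodUp-length i _ (n∸i≡1+[n∸1+i] i<n))
                (reflexive (≡.cong (λ k → hDown i k x) (n∸i≡1+[n∸1+i] i<n))) ⟩
    hUp i (suc (n ∸ suc i)) y * hDown i (suc (n ∸ suc i)) x
      ≈⟨ hUp-hDown (n ∸ suc i) i x y 1≤i (≤-reflexive (m+[n∸m]≡n i<n)) ⟩
    Aβ (suc i) x * (h i (x ⊕ y) * Ãβ (suc i) y) ∎

  h-commute-Aβ : ∀ {i j} r z → 1 ≤ i → suc (suc i) ≤ j → j < n → Commute (h i r) (Aβ j z)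
  h-commute-Aβ {i} {j} r z 1≤i i+2≤j j<n = prodDown-commute j (n ∸ j) _ λ l j≤l l<n →
    h-commute r z 1≤i (≤-trans i+2≤j j≤l) (≡.subst (l <_) (m+[n∸m]≡n (<⇒≤ j<n)) l<n)

  module _ (x : ℕ → R.Carrier) (y : R.Carrier) where

    As : ℕ → ℕ → Carrier
    As i k = prodUp i k (λ j → Aβ j (x j))

    As′ : ℕ → ℕ → Carrier
    As′ i k = prodUp i k (λ j → Aβ j (x (pred j)))

    Hs : ℕ → ℕ → Carrier
    Hs i k = prodUp i k (λ j → h j (x j ⊕ y))

    Ãβ-As : ∀ k i → 1 ≤ i → suc i +ℕ k ≡ n →
            Ãβ i y * As i (suc k) ≈ As′ (suc i) k * Hs i (suc k)
    Ãβ-As k i 1≤i i+k+1≡n = begin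
      Ãβ i y * (Aβ i (x i) * As (suc i) k)
        ≈⟨ sym (*-assoc _ _ _) ⟩
      (Ãβ i y * Aβ i (x i)) * As (suc i) k
        ≈⟨ *-congʳ (Ãβ-Aβ (x i) y 1≤i i<n) ⟩
      (Aβ (suc i) (x i) * (h i (x i ⊕ y) * Ãβ (suc i) y)) * As (suc i) k
        ≈⟨ trans (*-assoc _ _ _) (*-congˡ (*-assoc _ _ _)) ⟩
      Aβ (suc i) (x i) * (h i (x i ⊕ y) * (Ãβ (suc i) y * As (suc i) k))
        ≈⟨ tail k i+k+1≡n ⟩
      As′ (suc i) k * Hs i (suc k) ∎
      where
      i<n : i < n
      i<n = ≤-trans (s≤s (m≤m+n i k)) (≤-reflexive i+k+1≡n)
      tail : ∀ k → suc i +ℕ k ≡ n →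
             Aβ (suc i) (x i) * (h i (x i ⊕ y) * (Ãβ (suc i) y * As (suc i) k))
             ≈ As′ (suc i) k * Hs i (suc k)
      tail zero i+1≡n = *-cong (Aβ-empty (x i) n≤i+1)
        (*-congˡ (trans (*-identityʳ _) (Ãβ-empty y n≤i+1)))
        where
        n≤i+1 : n ≤ suc i
        n≤i+1 = ≤-reflexive (≡.trans (≡.sym i+1≡n) (≡.cong suc (+ℕ-identityʳ i)))
      tail (suc k) i+k+2≡n = begin
        A1 * (Hc * (Ãβ (suc i) y * As (suc i) (suc k)))
          ≈⟨ *-congˡ (*-congˡ (Ãβ-As k (suc i) (s≤s z≤n) (≡.trans (≡.sym (+-suc (suc i) k)) i+k+2≡n))) ⟩
        A1 * (Hc * (As′ (suc (suc i)) k * Hs (suc i) (suc k)))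
          ≈⟨ *-congˡ (commute-swapˡ _ Hc-As′) ⟩
        A1 * (As′ (suc (suc i)) k * (Hc * Hs (suc i) (suc k)))
          ≈⟨ sym (*-assoc _ _ _) ⟩
        As′ (suc i) (suc k) * Hs i (suc (suc k)) ∎
        where
        A1 = Aβ (suc i) (x i)
        Hc = h i (x i ⊕ y)
        Hc-As′ : Commute Hc (As′ (suc (suc i)) k)
        Hc-As′ = prodUp-commute (suc (suc i)) k _ λ l i+2≤l l<i+2+k →
          h-commute-Aβ (x i ⊕ y) (x (pred l)) 1≤i i+2≤l
            (≡.subst (l <_) (≡.trans (≡.sym (+-suc (suc i) k)) i+k+2≡n) l<i+2+k)

    Ãβ-Aβ-product : ∀ i → 1 ≤ i → i < n →
                    Ãβ i y * As i (n ∸ i) ≈ As′ (suc i) (n ∸ suc i) * Hs i (n ∸ i)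
    Ãβ-Aβ-product i 1≤i i<n = begin
      Ãβ i y * As i (n ∸ i)                                 ≈⟨ *-congˡ (prodUp-length i _ (n∸i≡1+[n∸1+i] i<n)) ⟩
      Ãβ i y * As i (suc (n ∸ suc i))                       ≈⟨ Ãβ-As (n ∸ suc i) i 1≤i (m+[n∸m]≡n i<n) ⟩
      As′ (suc i) (n ∸ suc i) * Hs i (suc (n ∸ suc i))      ≈⟨ *-congˡ (prodUp-length i _ (≡.sym (n∸i≡1+[n∸1+i] i<n))) ⟩
      As′ (suc i) (n ∸ suc i) * Hs i (n ∸ i)                ∎

lemma4p3 : {c ℓ a ℓa : Level} (R : CommutativeRing c ℓ) (β : CommutativeRing.Carrier R)
           (n : ℕ) (I : IdCoxAlgebra R β n a ℓa) →
           let open IdCoxAlgebra I in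
           let open Ring A in
           let open IdCoxNotation I in
           (i : ℕ) → 1 ≤ i → i < n →
           (x : ℕ → CommutativeRing.Carrier R) (y : CommutativeRing.Carrier R) →
           Ãβ i y * prodRange i (pred n) (λ j → Aβ j (x j))
             ≈ prodRange (suc i) (pred n) (λ j → Aβ j (x (pred j)))
               * prodRange i (pred n) (λ j → h j (x j ⊕ y))
-- For n = suc n′, prodRange i n′ F unfolds to prodUp i (suc n′ ∸ i) F.
lemma4p3 R β (suc n) I i 1≤i i<n x y = IdCoxProperties.Ãβ-Aβ-product I x y i 1≤i i<n
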